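{- Let $q\ge 1$ and $n\ge 1$ be integers and let $(S,X_i,\pi_i)_{i=1}^{q+2}$ be a transitive element of $(q+2)\text{ -OA}(n)$. Choose $s\in S$ and set $x_i=\pi_i(s)\in X_i$ for each $i$. Let $G=\mathrm{Aut}(S,X_i)$, $K=\mathrm{Stab}_G(s)$ and $H_i=\mathrm{Stab}_G(x_i)$ for $i=1,\dots,q+2$. Then $(G,H_i)_{i=1}^{q+2}$ is a group packet in $(q+2)\text{ -GP}(n)$ (with $K$ as the common pairwise intersection).
   Context: An element of $(q+2)\text{ -OA}(n)$ (an orthogonal array) is the data $(S,X_i,\pi_i)_{i=1}^{q+2}$ of a set $S$, sets $X_i$ with $|X_i|=n$, and maps $\pi_i\colon S\to X_i$ such that for all $i\ne j$ the map $\pi_i\times\pi_j\colon S\to X_i\times X_j$ is a bijection. Via the injective map $\prod_i\pi_i\colon S\to\prod_i X_i$, regard $S$ as a subset of $\prod_i X_i$. The autotopy group is $\mathrm{Aut}(S,X_i)=\{(\sigma_i)\in\prod_{i=1}^{q+2}\mathrm{Sym}(X_i): (\sigma_i)(S)=S\}$; it acts on each $X_i$ via $\sigma_i$ and on $S$ (as a subset of the product), and the $\pi_i$ are equivariant. The array is transitive if $\mathrm{Aut}(S,X_i)$ acts transitively on $S$. A group packet in $(q+2)\text{ -GP}(n)$ is the data $(G,H_i)_{i=1}^{q+2}$ of a group $G$ and subgroups $H_i\le G$ such that there is a subgroup $K$ with $H_i\cap H_j=K$ for all $i\neq j$ and $[G:H_i]=[H_i:K]=n$ for all $i$. -}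

module Defs where

open import Level using (0ℓ)
open import Data.Nat using (ℕ; suc; _+_; _≥_)
open import Data.Fin using (Fin)
open import Data.Product using (Σ; ∃; _×_; _,_; proj₁; proj₂)
open import Function using (_∘_; id)
open import Function.Bundles using (_↔_; Inverse; mk↔ₛ′)
open import Function.Definitions using (Bijective)
open import Relation.Binary.PropositionalEquality
  using (_≡_; _≢_; refl; sym; trans; cong; isEquivalence)
open import Relation.Binary.Core using (Rel)
open import Relation.Nullary using (¬_)
open import Algebra.Bundles using (Group)
open import Algebra.Structures using (IsGroup)
import Data.Unit

record IsOA (m n : ℕ) (S : Set) (X : Fin m → Set) (π : (i : Fin m) → S → X i) : Set where
  field
    card : (i : Fin m) → X i ↔ Fin n
    pairBij : (i j : Fin m) → i ≢ j →
              Bijective _≡_ _≡_ (λ s → (π i s , π j s))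

module Autotopy {m : ℕ} (S : Set) (X : Fin m → Set) (π : (i : Fin m) → S → X i) where

  Perm : Set → Set
  Perm A = A ↔ A

  -- (σ_i)(S) = S, with S regarded as a subset of ∏ X_i via ∏ π_i
  PreservesS : ((i : Fin m) → Perm (X i)) → Set
  PreservesS σ =
    (∀ s → ∃ λ s' → ∀ i → π i s' ≡ Inverse.to (σ i) (π i s))
    × (∀ s' → ∃ λ s → ∀ i → π i s' ≡ Inverse.to (σ i) (π i s))

  Carrier : Set
  Carrier = Σ ((i : Fin m) → Perm (X i)) PreservesS

  cmp : (i : Fin m) → Carrier → X i → X i
  cmp i g = Inverse.to (proj₁ g i)

  _≈_ : Rel Carrier 0ℓ
  g ≈ h = ∀ i x → cmp i g x ≡ cmp i h x

  _∙_ : Carrier → Carrier → Carrier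
  (σ , pσ) ∙ (τ , pτ) =
    (λ i → mk↔ₛ′ (Inverse.to (σ i) ∘ Inverse.to (τ i))
                 (Inverse.from (τ i) ∘ Inverse.from (σ i))
                 (λ y → trans (cong (Inverse.to (σ i)) (Inverse.strictlyInverseˡ (τ i) _))
                              (Inverse.strictlyInverseˡ (σ i) y))
                 (λ x → trans (cong (Inverse.from (τ i)) (Inverse.strictlyInverseʳ (σ i) _))
                              (Inverse.strictlyInverseʳ (τ i) x)))
    , (λ s → let (s₁ , e₁) = proj₁ pτ s ; (s₂ , e₂) = proj₁ pσ s₁
             in s₂ , λ i → trans (e₂ i) (cong (Inverse.to (σ i)) (e₁ i)))
    , (λ s' → let (s₁ , e₁) = proj₂ pσ s' ; (s₂ , e₂) = proj₂ pτ s₁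
              in s₂ , λ i → trans (e₁ i) (cong (Inverse.to (σ i)) (e₂ i)))

  ε : Carrier
  ε = (λ i → mk↔ₛ′ id id (λ _ → refl) (λ _ → refl))
    , (λ s → s , λ _ → refl) , (λ s → s , λ _ → refl)

  _⁻¹ : Carrier → Carrier
  (σ , pσ) ⁻¹ =
    (λ i → mk↔ₛ′ (Inverse.from (σ i)) (Inverse.to (σ i))
                 (Inverse.strictlyInverseʳ (σ i)) (Inverse.strictlyInverseˡ (σ i)))
    , (λ s → let (s₁ , e) = proj₂ pσ s
             in s₁ , λ i → trans (sym (Inverse.strictlyInverseʳ (σ i) (π i s₁)))
                                 (cong (Inverse.from (σ i)) (sym (e i))))
    , (λ s' → let (s₁ , e) = proj₁ pσ s'
              in s₁ , λ i → trans (sym (Inverse.strictlyInverseʳ (σ i) (π i s')))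
                                  (cong (Inverse.from (σ i)) (sym (e i))))

  private
    from-cong : ∀ {g h} → g ≈ h → ∀ i y →
                Inverse.from (proj₁ g i) y ≡ Inverse.from (proj₁ h i) y
    from-cong {σ , _} {τ , _} e i y =
      trans (sym (Inverse.strictlyInverseʳ (τ i) _))
            (trans (cong (Inverse.from (τ i)) (sym (e i _)))
                   (cong (Inverse.from (τ i)) (Inverse.strictlyInverseˡ (σ i) y)))

  isGroup : IsGroup _≈_ _∙_ ε _⁻¹
  isGroup = record
    { isMonoid = record
      { isSemigroup = record
        { isMagma = record
          { isEquivalence = record
            { refl = λ _ _ → refl
            ; sym = λ e i x → sym (e i x)
            ; trans = λ e f i x → trans (e i x) (f i x) }
          ; ∙-cong = λ {g} {g'} {h} {h'} e f i x →
              trans (e i _) (cong (cmp i g') (f i x)) }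
        ; assoc = λ _ _ _ _ _ → refl }
      ; identity = (λ _ _ _ → refl) , (λ _ _ _ → refl) }
    ; inverse = (λ g i x → Inverse.strictlyInverseʳ (proj₁ g i) x)
              , (λ g i x → Inverse.strictlyInverseˡ (proj₁ g i) x)
    ; ⁻¹-cong = λ {g} {h} e i y → from-cong {g} {h} e i y }

  AutGroup : Group 0ℓ 0ℓ
  AutGroup = record { isGroup = isGroup }

  _·_↦_ : Carrier → S → S → Set
  g · s ↦ s' = ∀ i → cmp i g (π i s) ≡ π i s'

  Transitive : Set
  Transitive = ∀ s s' → ∃ λ g → g · s ↦ s'

  StabS : S → Carrier → Set
  StabS s g = g · s ↦ s

  StabX : (i : Fin m) → X i → Carrier → Set
  StabX i x g = cmp i g x ≡ x

module _ (G : Group 0ℓ 0ℓ) where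
  open Group G

  record IsSubgroup (H : Carrier → Set) : Set where
    field
      resp  : ∀ {g h} → g ≈ h → H g → H h
      ε∈    : H ε
      ∙∈    : ∀ {g h} → H g → H h → H (g ∙ h)
      ⁻¹∈   : ∀ {g} → H g → H (g ⁻¹)

  -- [H : K] = n   (K ≤ H): there is a left transversal t_1..t_n of K in H,
  -- i.e. every h ∈ H lies in exactly one left coset t_k K.
  Index≡ : (H K : Carrier → Set) → ℕ → Set
  Index≡ H K n = Σ (Fin n → Carrier) λ t →
      (∀ k → H (t k))
    × (∀ h → H h → ∃ λ k → K (t k ⁻¹ ∙ h))
    × (∀ h k k' → K (t k ⁻¹ ∙ h) → K (t k' ⁻¹ ∙ h) → k ≡ k')

  record IsGroupPacket (m n : ℕ) (H : Fin m → Carrier → Set) (K : Carrier → Set) : Set where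
    field
      H-sub : ∀ i → IsSubgroup (H i)
      K-sub : IsSubgroup K
      inter : ∀ i j → i ≢ j → ∀ g → (H i g × H j g → K g) × (K g → H i g × H j g)
      index-G : ∀ i → Index≡ (λ _ → Data.Unit.⊤) (H i) n
      index-H : ∀ i → Index≡ (H i) K n

{-# OPTIONS --safe #-}
-- An autotopy fixing two coordinates of s fixes s, because an orthogonal array has
-- exactly one point with two prescribed coordinates. Both indices are orbit–stabiliser
-- counts: by transitivity G moves x_i to every point of X_i, and H_i moves x_j to every
-- point of X_j (there is a point of S above (x_i, y) for each y), while K is the
-- stabiliser of x_j in H_i.
module Submission where

open import Defs
open import Level using (0ℓ)
open import Algebra.Bundles using (Group)
open import Data.Nat using (ℕ; _+_; _≥_; _≤_; s≤s)
open import Data.Nat.Properties using (m≤n+m)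
open import Data.Fin using (Fin; zero; suc)
open import Data.Product using (∃; _×_; _,_; proj₁; proj₂)
open import Data.Product.Properties using (,-injective)
open import Data.Unit using (⊤; tt)
open import Function.Bundles using (_↔_; _⇔_; mk⇔; Inverse; Equivalence; Injection)
open import Function.Properties.Inverse using (↔-sym; ↔⇒↣)
open import Relation.Binary.PropositionalEquality
  using (_≡_; _≢_; refl; sym; trans; cong; cong₂; module ≡-Reasoning)

∃-≢ : ∀ {m} → 2 ≤ m → (i : Fin m) → ∃ (i ≢_)
∃-≢ (s≤s (s≤s _)) zero    = suc zero , λ ()
∃-≢ (s≤s (s≤s _)) (suc i) = zero , λ ()

module _ (G : Group 0ℓ 0ℓ) where
  open Group G using (Carrier; _∙_; _⁻¹)

  ⋂-isSubgroup : ∀ {I : Set} {H : I → Carrier → Set} →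
                 (∀ l → IsSubgroup G (H l)) → IsSubgroup G (λ g → ∀ l → H l g)
  ⋂-isSubgroup H-sub = record
    { resp = λ g≈h Hg l → IsSubgroup.resp (H-sub l) g≈h (Hg l)
    ; ε∈   = λ l → IsSubgroup.ε∈ (H-sub l)
    ; ∙∈   = λ Hg Hh l → IsSubgroup.∙∈ (H-sub l) (Hg l) (Hh l)
    ; ⁻¹∈  = λ Hg l → IsSubgroup.⁻¹∈ (H-sub l) (Hg l)
    }

  Index≡-fromOrbitMap : (H K : Carrier → Set) {A : Set} {n : ℕ} →
    A ↔ Fin n → (f : Carrier → A) →
    (∀ a → ∃ λ h → H h × f h ≡ a) →
    (∀ g h → H g → H h → f g ≡ f h → K (g ⁻¹ ∙ h)) →
    (∀ g h → K (g ⁻¹ ∙ h) → f g ≡ f h) →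
    Index≡ G H K n
  Index≡-fromOrbitMap H K {n = n} card f onto sameOrbit⇒K K⇒sameOrbit =
    t , t∈H , covers , unique
    where
    open Inverse card

    t : Fin n → Carrier
    t k = proj₁ (onto (from k))

    t∈H : ∀ k → H (t k)
    t∈H k = proj₁ (proj₂ (onto (from k)))

    f∘t : ∀ k → f (t k) ≡ from k
    f∘t k = proj₂ (proj₂ (onto (from k)))

    covers : ∀ h → H h → ∃ λ k → K (t k ⁻¹ ∙ h)
    covers h h∈H =
      to (f h) , sameOrbit⇒K (t _) h (t∈H _) h∈H (trans (f∘t _) (strictlyInverseʳ (f h)))

    unique : ∀ h k k′ → K (t k ⁻¹ ∙ h) → K (t k′ ⁻¹ ∙ h) → k ≡ k′
    unique h k k′ k∼h k′∼h = Injection.injective (↔⇒↣ (↔-sym card)) (begin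
      from k     ≡⟨ sym (f∘t k) ⟩
      f (t k)    ≡⟨ K⇒sameOrbit (t k) h k∼h ⟩
      f h        ≡⟨ sym (K⇒sameOrbit (t k′) h k′∼h) ⟩
      f (t k′)   ≡⟨ f∘t k′ ⟩
      from k′    ∎)
      where open ≡-Reasoning

module AutotopyProperties {m : ℕ} (S : Set) (X : Fin m → Set) (π : (i : Fin m) → S → X i) where
  open Autotopy S X π

  StabX-isSubgroup : ∀ i x → IsSubgroup AutGroup (StabX i x)
  StabX-isSubgroup i x = record
    { resp = λ g≈h gx≡x → trans (sym (g≈h i x)) gx≡x
    ; ε∈   = refl
    ; ∙∈   = λ {g} gx≡x hx≡x → trans (cong (cmp i g) hx≡x) gx≡x
    ; ⁻¹∈  = λ {g} gx≡x → Inverse.inverseʳ (proj₁ g i) (sym gx≡x)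
    }

  StabS-isSubgroup : ∀ s → IsSubgroup AutGroup (StabS s)
  StabS-isSubgroup s = ⋂-isSubgroup AutGroup (λ l → StabX-isSubgroup l (π l s))

  StabX-⁻¹∙⇔ : ∀ i x g h → StabX i x ((g ⁻¹) ∙ h) ⇔ (cmp i g x ≡ cmp i h x)
  StabX-⁻¹∙⇔ i x g h = mk⇔ (λ e → Inverse.inverseˡ (proj₁ g i) (sym e))
                           (λ e → Inverse.inverseʳ (proj₁ g i) (sym e))

  act : Carrier → S → S
  act g s = proj₁ (proj₁ (proj₂ g) s)

  π-act : ∀ g s l → π l (act g s) ≡ cmp l g (π l s)
  π-act g s = proj₂ (proj₁ (proj₂ g) s)

module _ {m n : ℕ} {S : Set} {X : Fin m → Set} {π : (i : Fin m) → S → X i}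
         (oa : IsOA m n S X π) where
  open Autotopy S X π
  open AutotopyProperties S X π
  open IsOA oa

  point : ∀ {i j} → i ≢ j → X i → X j → S
  point i≢j x y = proj₁ (proj₂ (pairBij _ _ i≢j) (x , y))

  π-point : ∀ {i j} (i≢j : i ≢ j) x y →
            π i (point i≢j x y) ≡ x × π j (point i≢j x y) ≡ y
  π-point i≢j x y = ,-injective (proj₂ (proj₂ (pairBij _ _ i≢j) (x , y)) refl)

  π-injective₂ : ∀ {i j} → i ≢ j → ∀ {a b} →
                 π i a ≡ π i b → π j a ≡ π j b → a ≡ b
  π-injective₂ i≢j eᵢ eⱼ = proj₁ (pairBij _ _ i≢j) (cong₂ _,_ eᵢ eⱼ)

  act-agree₂ : ∀ {i j} → i ≢ j → ∀ s g h →
               cmp i g (π i s) ≡ cmp i h (π i s) →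
               cmp j g (π j s) ≡ cmp j h (π j s) →
               ∀ l → cmp l g (π l s) ≡ cmp l h (π l s)
  act-agree₂ {i} {j} i≢j s g h eᵢ eⱼ l = begin
    cmp l g (π l s)   ≡⟨ sym (π-act g s l) ⟩
    π l (act g s)     ≡⟨ cong (π l) (π-injective₂ i≢j (agreeAt i eᵢ) (agreeAt j eⱼ)) ⟩
    π l (act h s)     ≡⟨ π-act h s l ⟩
    cmp l h (π l s)   ∎
    where
    open ≡-Reasoning
    agreeAt : ∀ k → cmp k g (π k s) ≡ cmp k h (π k s) → π k (act g s) ≡ π k (act h s)
    agreeAt k e = trans (π-act g s k) (trans e (sym (π-act h s k)))

  module _ (transitive : Transitive) (s : S) where

    StabX∩StabX⇔StabS : ∀ {i j} → i ≢ j → ∀ g →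
      (StabX i (π i s) g × StabX j (π j s) g → StabS s g) ×
      (StabS s g → StabX i (π i s) g × StabX j (π j s) g)
    StabX∩StabX⇔StabS {i} {j} i≢j g =
      (λ (gᵢ , gⱼ) → act-agree₂ i≢j s g ε gᵢ gⱼ) , (λ g∈K → g∈K i , g∈K j)

    StabX-index : ∀ {i j} → i ≢ j → Index≡ AutGroup (λ _ → ⊤) (StabX i (π i s)) n
    StabX-index {i} {j} i≢j =
      Index≡-fromOrbitMap AutGroup (λ _ → ⊤) (StabX i (π i s)) (card i)
        (λ g → cmp i g (π i s)) reach
        (λ g h _ _ → Equivalence.from (StabX-⁻¹∙⇔ i (π i s) g h))
        (λ g h → Equivalence.to (StabX-⁻¹∙⇔ i (π i s) g h))
      where
      reach : ∀ x → ∃ λ g → ⊤ × cmp i g (π i s) ≡ x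
      reach x with transitive s (point i≢j x (π j s))
      ... | g , g∙s↦p = g , tt , trans (g∙s↦p i) (proj₁ (π-point i≢j x (π j s)))

    StabS-index : ∀ {i j} → i ≢ j → Index≡ AutGroup (StabX i (π i s)) (StabS s) n
    StabS-index {i} {j} i≢j =
      Index≡-fromOrbitMap AutGroup (StabX i (π i s)) (StabS s) (card j)
        (λ g → cmp j g (π j s)) reach sameOrbit⇒K K⇒sameOrbit
      where
      reach : ∀ y → ∃ λ g → StabX i (π i s) g × cmp j g (π j s) ≡ y
      reach y with transitive s (point i≢j (π i s) y) | π-point i≢j (π i s) y
      ... | g , g∙s↦p | πᵢp≡xᵢ , πⱼp≡y =
        g , trans (g∙s↦p i) πᵢp≡xᵢ , trans (g∙s↦p j) πⱼp≡y

      sameOrbit⇒K : ∀ g h → StabX i (π i s) g → StabX i (π i s) h →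
                    cmp j g (π j s) ≡ cmp j h (π j s) → StabS s ((g ⁻¹) ∙ h)
      sameOrbit⇒K g h gᵢ hᵢ eⱼ l = Equivalence.from (StabX-⁻¹∙⇔ l (π l s) g h)
        (act-agree₂ i≢j s g h (trans gᵢ (sym hᵢ)) eⱼ l)

      K⇒sameOrbit : ∀ g h → StabS s ((g ⁻¹) ∙ h) → cmp j g (π j s) ≡ cmp j h (π j s)
      K⇒sameOrbit g h g⁻¹h∈K = Equivalence.to (StabX-⁻¹∙⇔ j (π j s) g h) (g⁻¹h∈K j)

    autotopy-isGroupPacket : 2 ≤ m →
      IsGroupPacket AutGroup m n (λ i → StabX i (π i s)) (StabS s)
    autotopy-isGroupPacket 2≤m = record
      { H-sub   = λ i → StabX-isSubgroup i (π i s)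
      ; K-sub   = StabS-isSubgroup s
      ; inter   = λ i j → StabX∩StabX⇔StabS
      ; index-G = λ i → StabX-index (proj₂ (∃-≢ 2≤m i))
      ; index-H = λ i → StabS-index (proj₂ (∃-≢ 2≤m i))
      }

-- Neither q ≥ 1 nor n ≥ 1 is needed: two coordinates suffice.
lemma3p9 : (q n : ℕ) → q ≥ 1 → n ≥ 1 →
    (S : Set) (X : Fin (q + 2) → Set) (π : (i : Fin (q + 2)) → S → X i) →
    IsOA (q + 2) n S X π →
    Autotopy.Transitive S X π →
    (s : S) →
    IsGroupPacket (Autotopy.AutGroup S X π) (q + 2) n
      (λ i → Autotopy.StabX S X π i (π i s))
      (Autotopy.StabS S X π s)
lemma3p9 q n _ _ S X π oa transitive s =
  autotopy-isGroupPacket oa transitive s (m≤n+m 2 q)
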